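{- Let $U=(E,\mathcal{D},\rho)$ be a U-matroid with $E\setminus\operatorname{Atom}(\mathcal{D})=\{a_1,\dots,a_m\}$, and let $\hat\rho=\rho_{a_1,\dots,a_m}=((\rho_{a_1})_{a_2}\cdots)_{a_m}$ be the iterated generous atom extension, a function on $2^E$. Then: (1) $\hat\rho(S)\ge\rho'(S)$ for all $S\subseteq E$, for every matroid extension $(E,2^E,\rho')$ of $\rho$ (i.e. every U-matroid on $2^E$ with $\rho'|_{\mathcal{D}}=\rho$); (2) $\hat\rho$ does not depend on the order in which $a_1,\dots,a_m$ are listed; (3) for every accessible distributive lattice $\mathcal{D}'$ with $\mathcal{D}\subseteq\mathcal{D}'\subseteq2^E$, the restriction $\hat\rho|_{\mathcal{D}'}$ dominates (is pointwise $\ge$) every other lattice extension of $U$ to $\mathcal{D}'$.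
   Context: $E$ is a finite set. A U-matroid is a triple $(E,\mathcal{D},\rho)$ where $\mathcal{D}\subseteq2^E$ contains $\emptyset,E$, is closed under union and intersection, and is accessible (every nonempty $A\in\mathcal{D}$ contains some $x$ with $A\setminus\{x\}\in\mathcal{D}$), and $\rho:\mathcal{D}\to\mathbb{N}$ satisfies $\rho(\emptyset)=0$, monotonicity, submodularity, and unit increase. A matroid is a U-matroid with $\mathcal{D}=2^E$. A lattice extension of $(E,\mathcal{D},\rho)$ to $\mathcal{D}'\supseteq\mathcal{D}$ is a U-matroid $(E,\mathcal{D}',\rho')$ with $\rho'|_{\mathcal{D}}=\rho$. $\operatorname{Atom}(\mathcal{D})=\{a\in E:\{a\}\in\mathcal{D}\}$. For $a\in E$ with $\{a\}\notin\mathcal{D}$, let $\mathcal{D}[a]=\mathcal{D}\cup\{S\cup\{a\}:S\in\mathcal{D}\}$, $\sup_{\mathcal{D}}(A)$ the smallest element of $\mathcal{D}$ containing $A$, and the generous atom extension $\rho_a:\mathcal{D}[a]\to\mathbb{N}$ is $\rho_a(S)=\rho(S)$ if $S\in\mathcal{D}$; $\rho(S\setminus\{a\})$ if $S\notin\mathcal{D}$ and $\rho(S\setminus\{a\})=\rho(\sup_{\mathcal{D}}(S))$; $\rho(S\setminus\{a\})+1$ if $S\notin\mathcal{D}$ and $\rho(S\setminus\{a\})<\rho(\sup_{\mathcal{D}}(S))$. This is a U-matroid on $\mathcal{D}[a]$, and $\operatorname{Atom}(\mathcal{D}[a])=\operatorname{Atom}(\mathcal{D})\cup\{a\}$, so the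 iteration is defined and ends at $2^E$. -}

module Defs where

open import Data.Nat using (ℕ; zero; suc; _≤_; _+_; _≡ᵇ_)
open import Data.Bool using (Bool; true; false; if_then_else_; _∧_; _∨_)
open import Data.Fin using (Fin)
open import Data.Fin.Subset
  using (Subset; outside; inside; ⊥; ⊤; ⁅_⁆; _∈_; _⊆_; _∩_; _∪_; _─_; _-_; ∣_∣)
open import Data.Fin.Subset.Properties using (_⊆?_; _∈?_)
open import Data.List using (List; []; _∷_; map; _++_; foldr; foldl)
open import Data.Vec using ([]; _∷_)
open import Data.Product using (Σ; _×_; _,_; proj₁; proj₂)
open import Relation.Nullary using (¬_; does)
open import Relation.Binary.PropositionalEquality using (_≡_)

Family : ℕ → Set
Family n = Subset n → Bool

-- A rank function; only its values on members of the family matter.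
Rank : ℕ → Set
Rank n = Subset n → ℕ

powerset : ∀ {n} → Family n
powerset _ = true

allSubsets : ∀ n → List (Subset n)
allSubsets zero = [] ∷ []
allSubsets (suc n) = map (outside ∷_) (allSubsets n) ++ map (inside ∷_) (allSubsets n)

record IsAccessibleLattice {n : ℕ} (D : Family n) : Set where
  field
    has-∅    : D ⊥ ≡ true
    has-E    : D ⊤ ≡ true
    closed-∪ : ∀ A B → D A ≡ true → D B ≡ true → D (A ∪ B) ≡ true
    closed-∩ : ∀ A B → D A ≡ true → D B ≡ true → D (A ∩ B) ≡ true
    accessible : ∀ A → D A ≡ true → ¬ (A ≡ ⊥) →
                 Σ (Fin n) (λ x → x ∈ A × D (A - x) ≡ true)

record IsUMatroid {n : ℕ} (D : Family n) (ρ : Rank n) : Set where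
  field
    lattice     : IsAccessibleLattice D
    rank-∅      : ρ ⊥ ≡ 0
    monotone    : ∀ A B → D A ≡ true → D B ≡ true → A ⊆ B → ρ A ≤ ρ B
    submodular  : ∀ A B → D A ≡ true → D B ≡ true →
                  ρ (A ∪ B) + ρ (A ∩ B) ≤ ρ A + ρ B
    unit-increase : ∀ A B → D A ≡ true → D B ≡ true → A ⊆ B →
                    ρ B ≤ ρ A + ∣ B ─ A ∣

isAtom : ∀ {n} → Family n → Fin n → Bool
isAtom D a = D ⁅ a ⁆

Extends : ∀ {n} → Family n → Rank n → Rank n → Set
Extends D ρ ρ' = ∀ S → D S ≡ true → ρ' S ≡ ρ S

-- sup_D(S): intersection of all members of D containing S
-- (the smallest member of D containing S when D is a lattice containing E).
sup : ∀ {n} → Family n → Subset n → Subset n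
sup {n} D S = foldr step ⊤ (allSubsets n)
  where
  step : Subset _ → Subset _ → Subset _
  step T acc = if D T ∧ does (S ⊆? T) then T ∩ acc else acc

-- D[a] = D ∪ { S ∪ {a} : S ∈ D }.
extFamily : ∀ {n} → Family n → Fin n → Family n
extFamily D a S = D S ∨ (does (a ∈? S) ∧ D (S - a))

-- Generous atom extension ρ_a (values outside D[a] are irrelevant).
extRank : ∀ {n} → Family n → Rank n → Fin n → Rank n
extRank D ρ a S =
  if D S then ρ S
  else (if ρ (S - a) ≡ᵇ ρ (sup D S) then ρ (S - a) else suc (ρ (S - a)))

genStep : ∀ {n} → Family n × Rank n → Fin n → Family n × Rank n
genStep (D , ρ) a = extFamily D a , extRank D ρ a

iterExt : ∀ {n} → Family n → Rank n → List (Fin n) → Family n × Rank n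
iterExt D ρ as = foldl genStep (D , ρ) as

hatρ : ∀ {n} → Family n → Rank n → List (Fin n) → Rank n
hatρ D ρ as = proj₂ (iterExt D ρ as)

{-# OPTIONS --safe #-}

-- The iterated generous extension has the closed form
--   ρ̂ S = min { ρ B + |S ∖ B| : B ∈ D },
-- which visibly does not depend on the order of the atoms. Any extension ρ' to a
-- ∪-closed family containing D is bounded by it, since ρ' S ≤ ρ' (S ∪ B) ≤ ρ B + |S ∖ B|
-- by monotonicity and unit increase. The closed form is reached by induction along the
-- extension: if D' ⊇ D is ∪- and ∩-closed, ρ' = ρ̂ on D', and S = T ∪ {a} with T ∈ D',
-- then ρ̂ S ∈ {ρ̂ T, ρ̂ T + 1}, and ρ̂ S = ρ̂ T forces ρ̂ T = ρ̂ (sup S): a minimiser B for S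
-- must contain a, so sup S ⊆ S ∪ B = T ∪ B ∈ D' and ρ̂ (sup S) ≤ ρ̂ (S ∪ B) ≤ ρ̂ S.
-- This is exactly the case distinction of the generous atom extension.
module Submission where

open import Defs
open import Data.Nat using (ℕ; _≤_)
open import Data.Bool using (false; true)
open import Data.Fin using (Fin)
open import Data.Fin.Subset using (Subset)
open import Data.List using (List)
open import Data.List.Membership.Propositional using (_∈_)
open import Data.List.Relation.Unary.Unique.Propositional using (Unique)
open import Data.List.Relation.Binary.Permutation.Propositional using (_↭_)
open import Data.Product using (_×_)
open import Relation.Binary.PropositionalEquality using (_≡_)

open import Data.Nat using (suc; s≤s; _+_; _<_; _≡ᵇ_; _≤?_)
import Data.Fin as Fin
open import Data.Nat.Properties
  using ( ≤-refl; ≤-trans; ≤-antisym; ≤-reflexive; ≤-<-trans; n≤1+n; ≰⇒>; <⇒≱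
        ; +-monoʳ-≤; +-monoʳ-<; +-suc; +-identityʳ; ≡ᵇ⇒≡; ≡⇒≡ᵇ; module ≤-Reasoning)
open import Data.Nat.Induction using (<-wellFounded)
open import Data.Bool using (T; if_then_else_; _∧_; _∨_)
import Data.Bool.Properties as Bool
open import Data.Fin.Properties using (_≟_)
open import Data.Fin.Subset
  using (inside; outside; ⊥; ⊤; ⁅_⁆; _∩_; _∪_; _─_; _-_; ∣_∣; _⊆_; _∉_)
  renaming (_∈_ to _∈ˢ_)
open import Data.Fin.Subset.Properties
open import Data.List using ([]; _∷_; map; _++_; filter; foldr)
open import Data.Vec using ([]; _∷_; here; there)
open import Data.List.Extrema.Nat using (argmin; argmin-all; f[argmin]≤v⁺)
open import Data.List.Membership.Propositional.Properties
  using (∈-map⁺; ∈-++⁺ˡ; ∈-++⁺ʳ; ∈-filter⁺)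
open import Data.List.Relation.Unary.All.Properties using (all-filter)
import Data.List.Relation.Unary.Any as Any
open import Data.List.Relation.Binary.Permutation.Propositional using (↭-sym)
open import Data.List.Relation.Binary.Permutation.Propositional.Properties using (∈-resp-↭)
open import Data.Product using (_,_; proj₁; proj₂)
open import Data.Sum using (_⊎_; inj₁; inj₂; [_,_]′)
open import Data.Empty using (⊥-elim)
open import Function using (id; _∘_)
open import Induction.WellFounded using (module All)
open import Level using (0ℓ)
open import Relation.Binary.Construct.On using () renaming (wellFounded to wellFounded-on)
open import Relation.Nullary using (Dec; does; yes; no; contradiction)
open import Relation.Binary.PropositionalEquality using (refl; sym; trans; cong; cong₂; subst; module ≡-Reasoning)

private
  variable
    n : ℕ

x∈p─q⇒x∉q : ∀ {x : Fin n} (p q : Subset n) → x ∈ˢ p ─ q → x ∉ q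
x∈p─q⇒x∉q (_ ∷ p) (outside ∷ q) here ()
x∈p─q⇒x∉q {x = Fin.zero} (_ ∷ p) (inside ∷ q) ()
x∈p─q⇒x∉q (_ ∷ p) (_ ∷ q) (there x∈p─q) (there x∈q) = x∈p─q⇒x∉q p q x∈p─q x∈q

p⊆q⇒p─r⊆q─r : ∀ {p q : Subset n} r → p ⊆ q → p ─ r ⊆ q ─ r
p⊆q⇒p─r⊆q─r {p = p} r p⊆q x∈p─r =
  x∈p∧x∉q⇒x∈p─q (p⊆q (p─q⊆p p r x∈p─r)) (x∈p─q⇒x∉q p r x∈p─r)

p─p≡⊥ : ∀ (p : Subset n) → p ─ p ≡ ⊥
p─p≡⊥ []            = refl
p─p≡⊥ (inside ∷ p)  = cong (outside ∷_) (p─p≡⊥ p)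
p─p≡⊥ (outside ∷ p) = cong (outside ∷_) (p─p≡⊥ p)

p∪q─r≡p─r∪q─r : ∀ (p q r : Subset n) → (p ∪ q) ─ r ≡ (p ─ r) ∪ (q ─ r)
p∪q─r≡p─r∪q─r []      []      []            = refl
p∪q─r≡p─r∪q─r (x ∷ p) (y ∷ q) (inside ∷ r)  = cong (outside ∷_) (p∪q─r≡p─r∪q─r p q r)
p∪q─r≡p─r∪q─r (x ∷ p) (y ∷ q) (outside ∷ r) = cong ((x ∨ y) ∷_) (p∪q─r≡p─r∪q─r p q r)

p∩q─r≡p─r∩q─r : ∀ (p q r : Subset n) → (p ∩ q) ─ r ≡ (p ─ r) ∩ (q ─ r)
p∩q─r≡p─r∩q─r []      []      []            = refl
p∩q─r≡p─r∩q─r (x ∷ p) (y ∷ q) (inside ∷ r)  = cong (outside ∷_) (p∩q─r≡p─r∩q─r p q r)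
p∩q─r≡p─r∩q─r (x ∷ p) (y ∷ q) (outside ∷ r) = cong (_ ∷_) (p∩q─r≡p─r∩q─r p q r)

p∩q─r≡p─r∩q : ∀ (p q r : Subset n) → (p ∩ q) ─ r ≡ (p ─ r) ∩ q
p∩q─r≡p─r∩q []      []      []            = refl
p∩q─r≡p─r∩q (x ∷ p) (y ∷ q) (inside ∷ r)  = cong (outside ∷_) (p∩q─r≡p─r∩q p q r)
p∩q─r≡p─r∩q (x ∷ p) (y ∷ q) (outside ∷ r) = cong (_ ∷_) (p∩q─r≡p─r∩q p q r)

p∪q─q≡p─q : ∀ (p q : Subset n) → (p ∪ q) ─ q ≡ p ─ q
p∪q─q≡p─q p q = begin
  (p ∪ q) ─ q        ≡⟨ p∪q─r≡p─r∪q─r p q q ⟩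
  (p ─ q) ∪ (q ─ q)  ≡⟨ cong ((p ─ q) ∪_) (p─p≡⊥ q) ⟩
  (p ─ q) ∪ ⊥        ≡⟨ ∪-identityʳ (p ─ q) ⟩
  p ─ q              ∎
  where open ≡-Reasoning

x∉p⇒p-x≡p : ∀ {x : Fin n} {p} → x ∉ p → p - x ≡ p
x∉p⇒p-x≡p {x = x} {p} x∉p =
  ⊆-antisym (p─q⊆p p ⁅ x ⁆) (λ y∈p → x∈p∧x≢y⇒x∈p-y y∈p λ { refl → x∉p y∈p })

q⊆p⇒p∪q≡p : ∀ {p q : Subset n} → q ⊆ p → p ∪ q ≡ p
q⊆p⇒p∪q≡p {p = p} {q} q⊆p = ⊆-antisym ([ id , q⊆p ]′ ∘ x∈p∪q⁻ p q) (p⊆p∪q q)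

x∈q⇒p-x∪q≡p∪q : ∀ {x : Fin n} {p q} → x ∈ˢ q → (p - x) ∪ q ≡ p ∪ q
x∈q⇒p-x∪q≡p∪q {x = x} {p} {q} x∈q = ⊆-antisym ⊆-∪ ⊇-∪
  where
  ⊆-∪ : (p - x) ∪ q ⊆ p ∪ q
  ⊆-∪ y∈ = x∈p∪q⁺ ([ inj₁ ∘ p─q⊆p p ⁅ x ⁆ , inj₂ ]′ (x∈p∪q⁻ (p - x) q y∈))
  ⊇-∪ : p ∪ q ⊆ (p - x) ∪ q
  ⊇-∪ {y} y∈ with x∈p∪q⁻ p q y∈ | y ≟ x
  ... | inj₂ y∈q | _      = x∈p∪q⁺ (inj₂ y∈q)
  ... | inj₁ _   | yes refl = x∈p∪q⁺ (inj₂ x∈q)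
  ... | inj₁ y∈p | no y≢x = x∈p∪q⁺ (inj₁ (x∈p∧x≢y⇒x∈p-y y∈p y≢x))

x∈p⇒p-x∪⁅x⁆≡p : ∀ {x : Fin n} {p} → x ∈ˢ p → (p - x) ∪ ⁅ x ⁆ ≡ p
x∈p⇒p-x∪⁅x⁆≡p {x = x} {p} x∈p =
  trans (x∈q⇒p-x∪q≡p∪q (x∈⁅x⁆ x)) (q⊆p⇒p∪q≡p ⁅x⁆⊆p)
  where
  ⁅x⁆⊆p : ⁅ x ⁆ ⊆ p
  ⁅x⁆⊆p y∈⁅x⁆ = subst (_∈ˢ p) (sym (x∈⁅y⁆⇒x≡y x y∈⁅x⁆)) x∈p

∣p∪⁅x⁆∣≤1+∣p∣ : ∀ (p : Subset n) x → ∣ p ∪ ⁅ x ⁆ ∣ ≤ suc ∣ p ∣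
∣p∪⁅x⁆∣≤1+∣p∣ (inside ∷ p)  Fin.zero    rewrite ∪-identityʳ p = n≤1+n _
∣p∪⁅x⁆∣≤1+∣p∣ (outside ∷ p) Fin.zero    rewrite ∪-identityʳ p = ≤-refl
∣p∪⁅x⁆∣≤1+∣p∣ (inside ∷ p)  (Fin.suc x) = s≤s (∣p∪⁅x⁆∣≤1+∣p∣ p x)
∣p∪⁅x⁆∣≤1+∣p∣ (outside ∷ p) (Fin.suc x) = ∣p∪⁅x⁆∣≤1+∣p∣ p x

∣p∣≤1+∣p-x∣ : ∀ (p : Subset n) x → ∣ p ∣ ≤ suc ∣ p - x ∣
∣p∣≤1+∣p-x∣ p x with x ∈? p
... | yes x∈p =
  subst (_≤ suc ∣ p - x ∣) (cong ∣_∣ (x∈p⇒p-x∪⁅x⁆≡p x∈p)) (∣p∪⁅x⁆∣≤1+∣p∣ (p - x) x)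
... | no x∉p  = subst (λ q → ∣ p ∣ ≤ suc ∣ q ∣) (sym (x∉p⇒p-x≡p x∉p)) (n≤1+n _)

infix 4 _∈ᶠ_ _∈ᶠ?_ _⊆ᶠ_

_∈ᶠ_ : Subset n → Family n → Set
S ∈ᶠ F = F S ≡ true

_⊆ᶠ_ : Family n → Family n → Set
F ⊆ᶠ G = ∀ S → S ∈ᶠ F → S ∈ᶠ G

∪-Closed : Family n → Set
∪-Closed F = ∀ A B → A ∈ᶠ F → B ∈ᶠ F → A ∪ B ∈ᶠ F

∩-Closed : Family n → Set
∩-Closed F = ∀ A B → A ∈ᶠ F → B ∈ᶠ F → A ∩ B ∈ᶠ F

allSubsets-complete : ∀ (S : Subset n) → S ∈ allSubsets n
allSubsets-complete []            = Any.here refl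
allSubsets-complete (outside ∷ S) = ∈-++⁺ˡ (∈-map⁺ (outside ∷_) (allSubsets-complete S))
allSubsets-complete {suc n} (inside ∷ S) =
  ∈-++⁺ʳ (map (outside ∷_) (allSubsets n)) (∈-map⁺ (inside ∷_) (allSubsets-complete S))

_∈ᶠ?_ : ∀ (S : Subset n) F → Dec (S ∈ᶠ F)
S ∈ᶠ? F = F S Bool.≟ true

members : Family n → List (Subset n)
members {n} F = filter (_∈ᶠ? F) (allSubsets n)

module _ (F : Family n) (S : Subset n) where

  private
    supStep : Subset n → Subset n → Subset n
    supStep T acc = if F T ∧ does (S ⊆? T) then T ∩ acc else acc

    foldr-⊇ : ∀ L → S ⊆ foldr supStep ⊤ L
    foldr-⊇ []      = ⊆⊤
    foldr-⊇ (T ∷ L) with F T | S ⊆? T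
    ... | true  | yes S⊆T = λ x∈S → x∈p∩q⁺ (S⊆T x∈S , foldr-⊇ L x∈S)
    ... | true  | no _    = foldr-⊇ L
    ... | false | _       = foldr-⊇ L

    foldr-least : ∀ L {C} → C ∈ L → C ∈ᶠ F → S ⊆ C → foldr supStep ⊤ L ⊆ C
    foldr-least (T ∷ L) C∈L C∈F S⊆C with F T in T∈F? | S ⊆? T | C∈L
    ... | true  | yes _   | Any.here refl = p∩q⊆p T _
    ... | true  | yes _   | Any.there C∈L = foldr-least L C∈L C∈F S⊆C ∘ p∩q⊆q T _
    ... | true  | no S⊈T  | Any.here refl = ⊥-elim (S⊈T S⊆C)
    ... | true  | no _    | Any.there C∈L = foldr-least L C∈L C∈F S⊆C
    ... | false | _       | Any.here refl = contradiction (trans (sym C∈F) T∈F?) λ ()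
    ... | false | _       | Any.there C∈L = foldr-least L C∈L C∈F S⊆C

    foldr-∈ᶠ : ⊤ ∈ᶠ F → ∩-Closed F → ∀ L → foldr supStep ⊤ L ∈ᶠ F
    foldr-∈ᶠ ⊤∈F F-∩ []      = ⊤∈F
    foldr-∈ᶠ ⊤∈F F-∩ (T ∷ L) with F T in T∈F | S ⊆? T
    ... | true  | yes _ = F-∩ T _ T∈F (foldr-∈ᶠ ⊤∈F F-∩ L)
    ... | true  | no _  = foldr-∈ᶠ ⊤∈F F-∩ L
    ... | false | _     = foldr-∈ᶠ ⊤∈F F-∩ L

  sup-⊇ : S ⊆ sup F S
  sup-⊇ = foldr-⊇ (allSubsets n)

  sup-least : ∀ {C} → C ∈ᶠ F → S ⊆ C → sup F S ⊆ C
  sup-least {C} = foldr-least (allSubsets n) (allSubsets-complete C)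

  sup-∈ᶠ : ⊤ ∈ᶠ F → ∩-Closed F → sup F S ∈ᶠ F
  sup-∈ᶠ ⊤∈F F-∩ = foldr-∈ᶠ ⊤∈F F-∩ (allSubsets n)

∪-Closed⇒total : ∀ {F : Family n} → ⊥ ∈ᶠ F → ∪-Closed F → (∀ x → ⁅ x ⁆ ∈ᶠ F) →
                 ∀ S → S ∈ᶠ F
∪-Closed⇒total {F = F} ⊥∈F F-∪ singletons =
  All.wfRec (wellFounded-on ∣_∣ <-wellFounded) 0ℓ (_∈ᶠ F) step
  where
  step : ∀ S → (∀ {T} → ∣ T ∣ < ∣ S ∣ → T ∈ᶠ F) → S ∈ᶠ F
  step S smaller∈F with nonempty? S
  ... | no S-empty   = subst (_∈ᶠ F) (sym (Empty-unique S-empty)) ⊥∈F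
  ... | yes (x , x∈S) = subst (_∈ᶠ F) (x∈p⇒p-x∪⁅x⁆≡p x∈S)
                          (F-∪ _ _ (smaller∈F (x∈p⇒∣p-x∣<∣p∣ x∈S)) (singletons x))

-- Generous atom extension of families

module _ {F : Family n} {a : Fin n} where

  extFamily-⊇ : F ⊆ᶠ extFamily F a
  extFamily-⊇ S S∈F rewrite S∈F = refl

  extFamily-∋ : ∀ {S} → a ∈ˢ S → S - a ∈ᶠ F → S ∈ᶠ extFamily F a
  extFamily-∋ {S} a∈S S-a∈F with F S | a ∈? S
  ... | true  | _         = refl
  ... | false | yes _     = S-a∈F
  ... | false | no a∉S    = contradiction a∈S a∉S

  extFamily-view : ∀ {S} → S ∈ᶠ extFamily F a → S ∈ᶠ F ⊎ (a ∈ˢ S × S - a ∈ᶠ F)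
  extFamily-view {S} S∈ with F S | a ∈? S
  ... | true  | _       = inj₁ refl
  ... | false | yes a∈S = inj₂ (a∈S , S∈)
  ... | false | no _    = contradiction S∈ λ ()

  private
    added∪old : ∪-Closed F → ∀ {A B} → a ∈ˢ A → A - a ∈ᶠ F → B ∈ᶠ F →
                A ∪ B ∈ᶠ extFamily F a
    added∪old F-∪ {A} {B} a∈A A-a∈F B∈F with a ∈? B
    ... | yes a∈B = extFamily-⊇ _ (subst (_∈ᶠ F) (x∈q⇒p-x∪q≡p∪q a∈B) (F-∪ _ _ A-a∈F B∈F))
    ... | no a∉B  = extFamily-∋ (x∈p∪q⁺ (inj₁ a∈A))
                      (subst (_∈ᶠ F) (sym A∪B-a≡A-a∪B) (F-∪ _ _ A-a∈F B∈F))
      where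
      A∪B-a≡A-a∪B : (A ∪ B) - a ≡ (A - a) ∪ B
      A∪B-a≡A-a∪B = trans (p∪q─r≡p─r∪q─r A B ⁅ a ⁆) (cong ((A - a) ∪_) (x∉p⇒p-x≡p a∉B))

    added∩old : ∩-Closed F → ∀ {A B} → a ∈ˢ A → A - a ∈ᶠ F → B ∈ᶠ F →
                A ∩ B ∈ᶠ extFamily F a
    added∩old F-∩ {A} {B} a∈A A-a∈F B∈F with a ∈? B
    ... | yes a∈B = extFamily-∋ (x∈p∩q⁺ (a∈A , a∈B))
                      (subst (_∈ᶠ F) (sym (p∩q─r≡p─r∩q A B ⁅ a ⁆)) (F-∩ _ _ A-a∈F B∈F))
    ... | no a∉B  = extFamily-⊇ _ (subst (_∈ᶠ F) A-a∩B≡A∩B (F-∩ _ _ A-a∈F B∈F))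
      where
      A-a∩B≡A∩B : (A - a) ∩ B ≡ A ∩ B
      A-a∩B≡A∩B = trans (sym (p∩q─r≡p─r∩q A B ⁅ a ⁆))
                        (x∉p⇒p-x≡p (a∉B ∘ proj₂ ∘ x∈p∩q⁻ A B))

  extFamily-∪-closed : ∪-Closed F → ∪-Closed (extFamily F a)
  extFamily-∪-closed F-∪ A B A∈ B∈ with extFamily-view A∈ | extFamily-view B∈
  ... | inj₁ A∈F            | inj₁ B∈F            = extFamily-⊇ _ (F-∪ A B A∈F B∈F)
  ... | inj₂ (a∈A , A-a∈F) | inj₁ B∈F            = added∪old F-∪ a∈A A-a∈F B∈F
  ... | inj₁ A∈F            | inj₂ (a∈B , B-a∈F) =
    subst (_∈ᶠ extFamily F a) (∪-comm B A) (added∪old F-∪ a∈B B-a∈F A∈F)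
  ... | inj₂ (a∈A , A-a∈F) | inj₂ (_ , B-a∈F)    = extFamily-∋ (x∈p∪q⁺ (inj₁ a∈A))
    (subst (_∈ᶠ F) (sym (p∪q─r≡p─r∪q─r A B ⁅ a ⁆)) (F-∪ _ _ A-a∈F B-a∈F))

  extFamily-∩-closed : ∩-Closed F → ∩-Closed (extFamily F a)
  extFamily-∩-closed F-∩ A B A∈ B∈ with extFamily-view A∈ | extFamily-view B∈
  ... | inj₁ A∈F            | inj₁ B∈F            = extFamily-⊇ _ (F-∩ A B A∈F B∈F)
  ... | inj₂ (a∈A , A-a∈F) | inj₁ B∈F            = added∩old F-∩ a∈A A-a∈F B∈F
  ... | inj₁ A∈F            | inj₂ (a∈B , B-a∈F) =
    subst (_∈ᶠ extFamily F a) (∩-comm B A) (added∩old F-∩ a∈B B-a∈F A∈F)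
  ... | inj₂ (a∈A , A-a∈F) | inj₂ (a∈B , B-a∈F) = extFamily-∋ (x∈p∩q⁺ (a∈A , a∈B))
    (subst (_∈ᶠ F) (sym (p∩q─r≡p─r∩q─r A B ⁅ a ⁆)) (F-∩ _ _ A-a∈F B-a∈F))

iterExt-⊇ : ∀ {F : Family n} {ρ} L → F ⊆ᶠ proj₁ (iterExt F ρ L)
iterExt-⊇ []      S S∈F = S∈F
iterExt-⊇ {F = F} (a ∷ L) S S∈F = iterExt-⊇ L S (extFamily-⊇ {F = F} {a} S S∈F)

iterExt-∋-singleton : ∀ {F : Family n} {ρ} L {x} → x ∈ L → ⊥ ∈ᶠ F →
                      ⁅ x ⁆ ∈ᶠ proj₁ (iterExt F ρ L)
iterExt-∋-singleton {F = F} (x ∷ L) (Any.here refl) ⊥∈F =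
  iterExt-⊇ L ⁅ x ⁆
    (extFamily-∋ {F = F} (x∈⁅x⁆ x) (subst (_∈ᶠ F) (sym (p─p≡⊥ ⁅ x ⁆)) ⊥∈F))
iterExt-∋-singleton {F = F} (a ∷ L) (Any.there x∈L) ⊥∈F =
  iterExt-∋-singleton L x∈L (extFamily-⊇ {F = F} {a} ⊥ ⊥∈F)

-- The closed form of the iterated generous extension

generousValue : ℕ → ℕ → ℕ
generousValue u v = if u ≡ᵇ v then u else suc u

generousValue-≡ : ∀ {u x v} → u ≤ x → x ≤ v → x ≤ suc u → (x ≤ u → v ≤ x) →
                  generousValue u v ≡ x
generousValue-≡ {u} {x} {v} u≤x x≤v x≤1+u flat with u ≡ᵇ v in u≡ᵇv
... | true  = ≤-antisym u≤x (≤-trans x≤v (≤-reflexive (sym (≡ᵇ⇒≡ u v (subst T (sym u≡ᵇv) _)))))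
... | false with x ≤? u
...   | yes x≤u = contradiction (≡⇒≡ᵇ u v u≡v) (subst T u≡ᵇv)
  where
  u≡v : u ≡ v
  u≡v = ≤-antisym (≤-trans u≤x x≤v) (≤-trans (flat x≤u) x≤u)
...   | no x≰u  = ≤-antisym (≰⇒> x≰u) x≤1+u

module MaxExtension (D : Family n) (ρ : Rank n) (⊤∈D : ⊤ ∈ᶠ D) where

  cost : Subset n → Subset n → ℕ
  cost S B = ρ B + ∣ S ─ B ∣

  minimiser : Subset n → Subset n
  minimiser S = argmin (cost S) ⊤ (members D)

  maxExt : Rank n
  maxExt S = cost S (minimiser S)

  minimiser∈D : ∀ S → minimiser S ∈ᶠ D
  minimiser∈D S = argmin-all (cost S) ⊤∈D (all-filter (_∈ᶠ? D) (allSubsets n))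

  maxExt-≤-cost : ∀ S {B} → B ∈ᶠ D → maxExt S ≤ cost S B
  maxExt-≤-cost S {B} B∈D =
    f[argmin]≤v⁺ ⊤ (members D) (inj₂ (Any.map (λ { refl → ≤-refl }) B∈members))
    where
    B∈members : B ∈ members D
    B∈members = ∈-filter⁺ (_∈ᶠ? D) (allSubsets-complete B) B∈D

  cost-mono : ∀ {X Y} B → X ⊆ Y → cost X B ≤ cost Y B
  cost-mono B X⊆Y = +-monoʳ-≤ (ρ B) (p⊆q⇒∣p∣≤∣q∣ (p⊆q⇒p─r⊆q─r B X⊆Y))

  cost-≤-suc : ∀ S a B → cost S B ≤ suc (cost (S - a) B)
  cost-≤-suc S a B = begin
    ρ B + ∣ S ─ B ∣            ≤⟨ +-monoʳ-≤ (ρ B) (∣p∣≤1+∣p-x∣ (S ─ B) a) ⟩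
    ρ B + suc ∣ S ─ B - a ∣    ≡⟨ +-suc (ρ B) _ ⟩
    suc (ρ B + ∣ S ─ B - a ∣)  ≡⟨ cong (λ T → suc (ρ B + ∣ T ∣)) (p─q─r≡p─r─q S B ⁅ a ⁆) ⟩
    suc (ρ B + ∣ S - a ─ B ∣)  ∎
    where open ≤-Reasoning

  cost-< : ∀ {S a} B → a ∈ˢ S → a ∉ B → cost (S - a) B < cost S B
  cost-< {S} {a} B a∈S a∉B = +-monoʳ-< (ρ B) (begin-strict
    ∣ S - a ─ B ∣  ≡⟨ cong ∣_∣ (p─q─r≡p─r─q S ⁅ a ⁆ B) ⟩
    ∣ S ─ B - a ∣  <⟨ x∈p⇒∣p-x∣<∣p∣ (x∈p∧x∉q⇒x∈p─q a∈S a∉B) ⟩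
    ∣ S ─ B ∣      ∎)
    where open ≤-Reasoning

  maxExt-mono : ∀ {X Y} → X ⊆ Y → maxExt X ≤ maxExt Y
  maxExt-mono {X} {Y} X⊆Y =
    ≤-trans (maxExt-≤-cost X (minimiser∈D Y)) (cost-mono (minimiser Y) X⊆Y)

  maxExt-≤-suc : ∀ S a → maxExt S ≤ suc (maxExt (S - a))
  maxExt-≤-suc S a =
    ≤-trans (maxExt-≤-cost S (minimiser∈D (S - a))) (cost-≤-suc S a (minimiser (S - a)))

  maxExt-∪-≤-cost : ∀ S {B} → B ∈ᶠ D → maxExt (S ∪ B) ≤ cost S B
  maxExt-∪-≤-cost S {B} B∈D = subst (maxExt (S ∪ B) ≤_)
    (cong (λ T → ρ B + ∣ T ∣) (p∪q─q≡p─q S B)) (maxExt-≤-cost (S ∪ B) B∈D)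

  extension-≤-maxExt : ∀ {D' ρ'} → IsUMatroid D' ρ' → D ⊆ᶠ D' → Extends D ρ ρ' →
                       ∀ {S} → S ∈ᶠ D' → ρ' S ≤ maxExt S
  extension-≤-maxExt {D'} {ρ'} M' D⊆D' ρ'-extends {S} S∈D' = begin
    ρ' S                    ≤⟨ monotone S (S ∪ B) S∈D' S∪B∈D' (p⊆p∪q B) ⟩
    ρ' (S ∪ B)              ≤⟨ unit-increase B (S ∪ B) B∈D' S∪B∈D' (q⊆p∪q S B) ⟩
    ρ' B + ∣ (S ∪ B) ─ B ∣  ≡⟨ cong₂ _+_ (ρ'-extends B (minimiser∈D S))
                                         (cong ∣_∣ (p∪q─q≡p─q S B)) ⟩
    maxExt S                ∎
    where
    open IsUMatroid M'
    open IsAccessibleLattice lattice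
    open ≤-Reasoning
    B = minimiser S
    B∈D' = D⊆D' B (minimiser∈D S)
    S∪B∈D' = closed-∪ S B S∈D' B∈D'

  maxExt-extends : IsUMatroid D ρ → Extends D ρ maxExt
  maxExt-extends M S S∈D = ≤-antisym (≤-trans (maxExt-≤-cost S S∈D) (≤-reflexive cost-S-S))
                                     (extension-≤-maxExt M (λ _ → id) (λ _ _ → refl) S∈D)
    where
    cost-S-S : cost S S ≡ ρ S
    cost-S-S = begin
      ρ S + ∣ S ─ S ∣  ≡⟨ cong (λ T → ρ S + ∣ T ∣) (p─p≡⊥ S) ⟩
      ρ S + ∣ ⊥ {n} ∣  ≡⟨ cong (ρ S +_) (∣⊥∣≡0 n) ⟩
      ρ S + 0          ≡⟨ +-identityʳ (ρ S) ⟩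
      ρ S              ∎
      where open ≡-Reasoning

  maxExt-sup-≤ : ∀ {D'} → D ⊆ᶠ D' → ∪-Closed D' → ∀ {S a} → a ∈ˢ S → S - a ∈ᶠ D' →
                 maxExt S ≤ maxExt (S - a) → maxExt (sup D' S) ≤ maxExt S
  maxExt-sup-≤ {D'} D⊆D' D'-∪ {S} {a} a∈S S-a∈D' flat with a ∈? minimiser S
  ... | no a∉B  = contradiction flat (<⇒≱ (≤-<-trans (maxExt-≤-cost (S - a) (minimiser∈D S))
                                                     (cost-< (minimiser S) a∈S a∉B)))
  ... | yes a∈B = ≤-trans (maxExt-mono (sup-least D' S S∪B∈D' (p⊆p∪q B)))
                          (maxExt-∪-≤-cost S (minimiser∈D S))
    where
    B = minimiser S
    S∪B∈D' : S ∪ B ∈ᶠ D'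
    S∪B∈D' = subst (_∈ᶠ D') (x∈q⇒p-x∪q≡p∪q a∈B) (D'-∪ _ _ S-a∈D' (D⊆D' B (minimiser∈D S)))

  record Approximant (D' : Family n) (ρ' : Rank n) : Set where
    field
      ⊇D       : D ⊆ᶠ D'
      closed-∪ : ∪-Closed D'
      closed-∩ : ∩-Closed D'
      agrees   : Extends D' ρ' maxExt

  module _ {D' ρ'} (I : Approximant D' ρ') (a : Fin n) where
    open Approximant I

    extRank-agrees : Extends (extFamily D' a) (extRank D' ρ' a) maxExt
    -- Abstracting over D' S also reduces extRank D' ρ' a S to the branch it selects.
    extRank-agrees S S∈ with D' S in S∈D'? | extFamily-view {F = D'} S∈
    ... | true  | _                  = agrees S S∈D'?
    ... | false | inj₁ ()
    ... | false | inj₂ (a∈S , S-a∈D') = sym (begin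
      generousValue (ρ' (S - a)) (ρ' (sup D' S))
        ≡⟨ cong₂ generousValue (sym (agrees _ S-a∈D')) (sym (agrees _ sup∈D')) ⟩
      generousValue (maxExt (S - a)) (maxExt (sup D' S))
        ≡⟨ generousValue-≡ (maxExt-mono (p─q⊆p S ⁅ a ⁆)) (maxExt-mono (sup-⊇ D' S))
                           (maxExt-≤-suc S a) (maxExt-sup-≤ ⊇D closed-∪ a∈S S-a∈D') ⟩
      maxExt S
        ∎)
      where
      open ≡-Reasoning
      sup∈D' = sup-∈ᶠ D' S (⊇D ⊤ ⊤∈D) closed-∩

    approximant-extRank : Approximant (extFamily D' a) (extRank D' ρ' a)
    approximant-extRank = record
      { ⊇D       = λ S → extFamily-⊇ {F = D'} {a} S ∘ ⊇D S
      ; closed-∪ = extFamily-∪-closed closed-∪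
      ; closed-∩ = extFamily-∩-closed closed-∩
      ; agrees   = extRank-agrees
      }

  approximant-iterExt : ∀ {D' ρ'} → Approximant D' ρ' → ∀ L →
                        Approximant (proj₁ (iterExt D' ρ' L)) (proj₂ (iterExt D' ρ' L))
  approximant-iterExt I []      = I
  approximant-iterExt I (a ∷ L) = approximant-iterExt (approximant-extRank I a) L

  approximant-D : IsUMatroid D ρ → Approximant D ρ
  approximant-D M = record
    { ⊇D       = λ _ → id
    ; closed-∪ = closed-∪
    ; closed-∩ = closed-∩
    ; agrees   = maxExt-extends M
    }
    where open IsAccessibleLattice (IsUMatroid.lattice M)

  hatρ≡maxExt : IsUMatroid D ρ → ∀ L → (∀ x → isAtom D x ≡ false → x ∈ L) →
                ∀ S → hatρ D ρ L S ≡ maxExt S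
  hatρ≡maxExt M L non-atoms∈L S =
    sym (agrees S (∪-Closed⇒total (⊇D ⊥ has-∅) closed-∪ singleton∈ S))
    where
    open IsAccessibleLattice (IsUMatroid.lattice M) using (has-∅)
    I = approximant-iterExt (approximant-D M) L
    open Approximant I
    singleton∈ : ∀ x → ⁅ x ⁆ ∈ᶠ proj₁ (iterExt D ρ L)
    singleton∈ x with D ⁅ x ⁆ in x-atom?
    ... | true  = ⊇D ⁅ x ⁆ x-atom?
    ... | false = iterExt-∋-singleton L (non-atoms∈L x x-atom?) has-∅

theorem4p12 : ∀ (n : ℕ) (D : Family n) (ρ : Rank n) → IsUMatroid D ρ →
    (as : List (Fin n)) → Unique as → (∀ x → (x ∈ as → isAtom D x ≡ false) × (isAtom D x ≡ false → x ∈ as)) →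
    ((ρ' : Rank n) → IsUMatroid powerset ρ' → Extends D ρ ρ' →
       ∀ (S : Subset n) → ρ' S ≤ hatρ D ρ as S)
    × ((bs : List (Fin n)) → bs ↭ as → ∀ (S : Subset n) → hatρ D ρ bs S ≡ hatρ D ρ as S)
    × ((D' : Family n) → IsAccessibleLattice D' → (∀ S → D S ≡ true → D' S ≡ true) →
       (ρ' : Rank n) → IsUMatroid D' ρ' → Extends D ρ ρ' →
       ∀ (S : Subset n) → D' S ≡ true → ρ' S ≤ hatρ D ρ as S)
theorem4p12 n D ρ M as _ atoms = dominates-matroids , order-independent , dominates-lattice-extensions
  where
  open MaxExtension D ρ (IsAccessibleLattice.has-E (IsUMatroid.lattice M))

  non-atoms∈as : ∀ x → isAtom D x ≡ false → x ∈ as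
  non-atoms∈as x = proj₂ (atoms x)

  dominates-lattice-extensions : (D' : Family n) → IsAccessibleLattice D' → D ⊆ᶠ D' →
    (ρ' : Rank n) → IsUMatroid D' ρ' → Extends D ρ ρ' → ∀ S → S ∈ᶠ D' → ρ' S ≤ hatρ D ρ as S
  dominates-lattice-extensions _ _ D⊆D' ρ' M' ρ'-extends S S∈D' =
    subst (ρ' S ≤_) (sym (hatρ≡maxExt M as non-atoms∈as S))
      (extension-≤-maxExt M' D⊆D' ρ'-extends S∈D')

  dominates-matroids : (ρ' : Rank n) → IsUMatroid powerset ρ' → Extends D ρ ρ' →
                       ∀ S → ρ' S ≤ hatρ D ρ as S
  dominates-matroids ρ' M' ρ'-extends S =
    dominates-lattice-extensions powerset (IsUMatroid.lattice M') (λ _ _ → refl) ρ' M' ρ'-extends S refl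

  order-independent : (bs : List (Fin n)) → bs ↭ as → ∀ S → hatρ D ρ bs S ≡ hatρ D ρ as S
  order-independent bs bs↭as S =
    trans (hatρ≡maxExt M bs (λ x → ∈-resp-↭ (↭-sym bs↭as) ∘ non-atoms∈as x) S)
          (sym (hatρ≡maxExt M as non-atoms∈as S))
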